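{- Let $p$ be a prime, $n\geq 1$ and $k\geq 1$ integers, and $q$ an integer with $\gcd(q,p)=1$. Let $\Gamma_{p,n,q}$ be the directed graph with vertex set $\mathbb{Z}_{p^n}=\{0,1,\dots,p^n-1\}$ and edge set $E=\{(x,\, q^y \bmod p^n)\;:\; x\in\mathbb{Z}_{p^n},\ y\in\mathbb{Z}_{\geq 0},\ y\equiv x \pmod{p^n}\}$. Let $C_{p,n,q}(k)$ denote the number of $k$-cycles with marked initial vertex in $\Gamma_{p,n,q}$, i.e. the number of sequences $(x_0,x_1,\dots,x_{k-1})$ of vertices such that $(x_i,x_{i+1})\in E$ for $0\le i\le k-2$ and $(x_{k-1},x_0)\in E$ (equivalently, the trace of the $k$-th power of the adjacency matrix). Then $C_{p,n,q}(k)\leq (p-1)^k$. Moreover, if $q$ is a primitive root modulo $p$, then $C_{p,n,q}(k)=(p-1)^k$.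
   Context: Here $q^y \bmod p^n$ denotes the least nonnegative residue of $q^y$ modulo $p^n$. The paper assumes throughout that $\gcd(q,p)=1$. -}

module Defs where

open import Data.Nat using (ℕ; zero; suc; _+_; _∸_; _<_; NonZero)
  renaming (_^_ to _^ℕ_; _%_ to _%_)
open import Data.Nat.Properties using (m^n≢0)
open import Data.Nat.Primality using (Prime; prime⇒nonZero)
open import Data.Integer using (ℤ) renaming (_^_ to _^ℤ_)
open import Data.Integer.DivMod using (_%ℕ_)
open import Data.Fin using (Fin; toℕ)
open import Data.Vec using (Vec; lookup)
open import Data.List using (List; length)
open import Data.List.Membership.Propositional using (_∈_)
open import Data.List.Relation.Unary.Unique.Propositional using (Unique)
open import Data.Product using (Σ; ∃; _×_)
open import Data.Sum using (_⊎_)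
open import Relation.Binary.PropositionalEquality using (_≡_; _≢_)
open import Function.Bundles using (_⇔_)

modNZ : (p : ℕ) → Prime p → (n : ℕ) → NonZero (p ^ℕ n)
modNZ p pr n = m^n≢0 p n {{prime⇒nonZero pr}}

Vertex : ℕ → ℕ → Set
Vertex p n = Fin (p ^ℕ n)

Edge : (p : ℕ) → Prime p → (n : ℕ) → ℤ → Vertex p n → Vertex p n → Set
Edge p pr n q x z =
  ∃ λ (y : ℕ) →
    ((y % (p ^ℕ n)) {{modNZ p pr n}} ≡ toℕ x)
    × ((q ^ℤ y) %ℕ (p ^ℕ n)) {{modNZ p pr n}} ≡ toℕ z

CycSucc : {k : ℕ} → Fin k → Fin k → Set
CycSucc {k} i j = (suc (toℕ i) ≡ toℕ j) ⊎ ((suc (toℕ i) ≡ k) × (toℕ j ≡ 0))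

IsCycle : (p : ℕ) → Prime p → (n : ℕ) → ℤ → (k : ℕ) → Vec (Vertex p n) k → Set
IsCycle p pr n q k v =
  (i j : Fin k) → CycSucc i j → Edge p pr n q (lookup v i) (lookup v j)

HasCard : {A : Set} → (A → Set) → ℕ → Set
HasCard {A} P m =
  Σ (List A) λ xs → Unique xs × (length xs ≡ m) × ((a : A) → (a ∈ xs) ⇔ P a)

PrimitiveRoot : (p : ℕ) → Prime p → ℤ → Set
PrimitiveRoot p pr q =
  ((q ^ℤ (p ∸ 1)) %ℕ p) {{prime⇒nonZero pr}} ≡ 1
  × ((j : ℕ) → 0 < j → j < p ∸ 1 → ((q ^ℤ j) %ℕ p) {{prime⇒nonZero pr}} ≢ 1)

module Submission where

-- Put N = p^n and Q = q mod N; the arrows out of x go to Q^y mod N with y ≡ x (mod N), and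
-- every vertex on a cycle is prime to p. A cycle is determined by the residues of its vertices
-- modulo p: if two cycles agree modulo p^m, the exponents of corresponding arrows agree modulo
-- p^m, and Q^(y + p^m s) ≡ Q^y (mod p) forces Q^s ≡ 1 (mod p), whence Q^(p^m s) ≡ 1 (mod p^(m+1));
-- so the vertices agree modulo p^(m+1). This injects the cycles into ((ℤ/p)^×)^k.
-- If q is a primitive root, so is Q^N modulo p, because gcd (N, p − 1) = 1; hence from any x the
-- arrows reach every nonzero residue. Choosing at each position the arrow with the prescribed
-- residue defines a map on labellings that gains one p-adic digit per application, and after n
-- iterations it yields a cycle with any prescribed residues.

open import Defs using (CycSucc; Vertex; Edge; IsCycle; HasCard; PrimitiveRoot)

open import Data.Empty using (⊥-elim)
open import Data.Fin as Fin using (Fin; toℕ; fromℕ; fromℕ<; inject₁; punchOut)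
import Data.Fin.Properties as Finₚ
open import Data.Integer as ℤ using (ℤ; ∣_∣; _%ℕ_; _/ℕ_)
  renaming (_+_ to _+ℤ_; _*_ to _*ℤ_; _^_ to _^ℤ_; _-_ to _-ℤ_; -_ to -ℤ_)
open import Data.Integer.DivMod using (a≡a%ℕn+[a/ℕn]*n; n%ℕd<d)
import Data.Integer.Divisibility.Signed as ℤ∣
import Data.Integer.Properties as ℤₚ
import Data.Integer.Tactic.RingSolver as ℤ-Solver
open import Data.List using (List; []; _∷_; length; cartesianProductWith; allFin; map; _++_; filter)
open import Data.List.Membership.Propositional using (_∈_)
open import Data.List.Membership.Propositional.Properties
  using (∈-allFin; ∈-cartesianProductWith⁺; ∈-filter⁺; ∈-filter⁻)
open import Data.List.Properties using (length-++; length-map; length-tabulate)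
import Data.List.Relation.Unary.All as All
open import Data.List.Relation.Unary.AllPairs using ([]; _∷_)
open import Data.List.Relation.Unary.Any using (here; there)
open import Data.List.Relation.Unary.Unique.Propositional using (Unique)
open import Data.List.Relation.Unary.Unique.Propositional.Properties using (cartesianProductWith⁺; allFin⁺; filter⁺)
open import Data.Nat
open import Data.Nat using () renaming (_^_ to _^ℕ_)
open import Data.Nat.Coprimality using (Coprime; coprime-divisor; coprime-Bézout; prime⇒coprime)
import Data.Nat.Coprimality as Coprimality
open import Data.Nat.DivMod hiding (_mod_)
open import Data.Nat.Divisibility
open import Data.Nat.GCD using (module Bézout; module GCD)
open import Data.Nat.Primality using (Prime; prime⇒nonZero; prime⇒nonTrivial; euclidsLemma)
open import Data.Nat.Properties
open import Data.Nat.Tactic.RingSolver using (solve-∀)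
open import Data.Product using (Σ; ∃; _×_; _,_; proj₁; proj₂)
open import Data.Sum using (inj₁; inj₂)
open import Data.Vec as Vec using (Vec; []; _∷_; lookup; tabulate)
import Data.Vec.Properties as Vecₚ
open import Function using (_∘_)
open import Function.Bundles using (_⇔_; mk⇔; module Equivalence)
open import Relation.Binary.Definitions using (tri<; tri≈; tri>)
open import Relation.Binary.PropositionalEquality
open import Relation.Nullary using (¬_; Dec; yes; no)
open import Relation.Nullary.Decidable using (map′; _×-dec_)
open import Relation.Unary using (Decidable)

open ≡-Reasoning

-- a ≡ b (mod M) as a + u M = b + v M: no subtraction and no side condition M ≢ 0.
infix 4 _≡_mod_
_≡_mod_ : ℕ → ℕ → ℕ → Set
_≡_mod_ a b M = ∃ λ u → ∃ λ v → a + u * M ≡ b + v * M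

mod-refl : ∀ {M} a → a ≡ a mod M
mod-refl a = 0 , 0 , refl

mod-sym : ∀ {M a b} → a ≡ b mod M → b ≡ a mod M
mod-sym (u , v , e) = v , u , sym e

mod-trans : ∀ {M a b c} → a ≡ b mod M → b ≡ c mod M → a ≡ c mod M
mod-trans {M} {a} {b} {c} (u , v , a≡b) (u′ , v′ , b≡c) = u + u′ , v + v′ , (begin
  a + (u + u′) * M     ≡⟨ split a u u′ M ⟩
  (a + u * M) + u′ * M ≡⟨ cong (_+ u′ * M) a≡b ⟩
  (b + v * M) + u′ * M ≡⟨ swap b v u′ M ⟩
  (b + u′ * M) + v * M ≡⟨ cong (_+ v * M) b≡c ⟩
  (c + v′ * M) + v * M ≡⟨ merge c v v′ M ⟩
  c + (v + v′) * M     ∎)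
  where
  split : ∀ a u u′ M → a + (u + u′) * M ≡ (a + u * M) + u′ * M
  split = solve-∀
  swap : ∀ b v u′ M → (b + v * M) + u′ * M ≡ (b + u′ * M) + v * M
  swap = solve-∀
  merge : ∀ c v v′ M → (c + v′ * M) + v * M ≡ c + (v + v′) * M
  merge = solve-∀

mod-reflexive : ∀ {M a b} → a ≡ b → a ≡ b mod M
mod-reflexive refl = mod-refl _

mod-* : ∀ {M a b c d} → a ≡ b mod M → c ≡ d mod M → a * c ≡ b * d mod M
mod-* {M} {a} {b} {c} {d} (u , v , a≡b) (u′ , v′ , c≡d) =
  u * c + a * u′ + u * u′ * M , v * d + b * v′ + v * v′ * M , (begin
    a * c + (u * c + a * u′ + u * u′ * M) * M ≡⟨ expand a c u u′ M ⟨
    (a + u * M) * (c + u′ * M)                ≡⟨ cong₂ _*_ a≡b c≡d ⟩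
    (b + v * M) * (d + v′ * M)                ≡⟨ expand b d v v′ M ⟩
    b * d + (v * d + b * v′ + v * v′ * M) * M ∎)
  where
  expand : ∀ a c u u′ M → (a + u * M) * (c + u′ * M) ≡ a * c + (u * c + a * u′ + u * u′ * M) * M
  expand = solve-∀

mod-^ : ∀ {M a b} e → a ≡ b mod M → a ^ e ≡ b ^ e mod M
mod-^ zero    _   = mod-refl 1
mod-^ (suc e) a≡b = mod-* a≡b (mod-^ e a≡b)

mod-∣ : ∀ {d M a b} → d ∣ M → a ≡ b mod M → a ≡ b mod d
mod-∣ {d} {M} {a} {b} (divides e refl) (u , v , a≡b) = u * e , v * e , (begin
  a + u * e * d   ≡⟨ cong (a +_) (*-assoc u e d) ⟩
  a + u * (e * d) ≡⟨ a≡b ⟩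
  b + v * (e * d) ≡⟨ cong (b +_) (*-assoc v e d) ⟨
  b + v * e * d   ∎)

mod-1 : ∀ a b → a ≡ b mod 1
mod-1 a b = b , a , (begin
  a + b * 1 ≡⟨ cong (a +_) (*-identityʳ b) ⟩
  a + b     ≡⟨ +-comm a b ⟩
  b + a     ≡⟨ cong (b +_) (*-identityʳ a) ⟨
  b + a * 1 ∎)

mod⇒%≡ : ∀ {M a b} .{{_ : NonZero M}} → a ≡ b mod M → a % M ≡ b % M
mod⇒%≡ {M} {a} {b} (u , v , a≡b) = begin
  a % M           ≡⟨ [m+kn]%n≡m%n a u M ⟨
  (a + u * M) % M ≡⟨ cong (_% M) a≡b ⟩
  (b + v * M) % M ≡⟨ [m+kn]%n≡m%n b v M ⟩
  b % M           ∎

%≡⇒mod : ∀ {M a b} .{{_ : NonZero M}} → a % M ≡ b % M → a ≡ b mod M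
%≡⇒mod {M} {a} {b} a%≡b% = b / M , a / M , (begin
  a + b / M * M                   ≡⟨ cong (_+ b / M * M) (m≡m%n+[m/n]*n a M) ⟩
  a % M + a / M * M + b / M * M   ≡⟨ cong (λ r → r + a / M * M + b / M * M) a%≡b% ⟩
  b % M + a / M * M + b / M * M   ≡⟨ swap (b % M) (a / M * M) (b / M * M) ⟩
  b % M + b / M * M + a / M * M   ≡⟨ cong (_+ a / M * M) (m≡m%n+[m/n]*n b M) ⟨
  b + a / M * M                   ∎)
  where
  swap : ∀ x y z → x + y + z ≡ x + z + y
  swap = solve-∀

%-mod : ∀ M a .{{_ : NonZero M}} → a % M ≡ a mod M
%-mod M a = %≡⇒mod (m%n%n≡m%n a M)

mod⇒≡ : ∀ {M a b} → a < M → b < M → a ≡ b mod M → a ≡ b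
mod⇒≡ {M} {a} {b} a<M b<M a≡b = begin
  a     ≡⟨ m<n⇒m%n≡m a<M ⟨
  a % M ≡⟨ mod⇒%≡ a≡b ⟩
  b % M ≡⟨ m<n⇒m%n≡m b<M ⟩
  b     ∎
  where instance _ = >-nonZero (≤-<-trans z≤n a<M)

mod-≤⇒∣∸ : ∀ {M a b} → a ≡ b mod M → a ≤ b → M ∣ b ∸ a
mod-≤⇒∣∸ {M} {a} {b} (u , v , a≡b) a≤b = divides (u ∸ v) (begin
  b ∸ a                 ≡⟨ m+n∸n≡m (b ∸ a) (v * M) ⟨
  b ∸ a + v * M ∸ v * M ≡⟨ cong (_∸ v * M) uM≡ ⟨
  u * M ∸ v * M         ≡⟨ *-distribʳ-∸ M u v ⟨
  (u ∸ v) * M           ∎)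
  where
  uM≡ : u * M ≡ b ∸ a + v * M
  uM≡ = +-cancelˡ-≡ a _ _ (begin
    a + u * M           ≡⟨ a≡b ⟩
    b + v * M           ≡⟨ cong (_+ v * M) (m+[n∸m]≡n a≤b) ⟨
    a + (b ∸ a) + v * M ≡⟨ +-assoc a (b ∸ a) (v * M) ⟩
    a + (b ∸ a + v * M) ∎)

∣∸⇒mod : ∀ {M a b} → a ≤ b → M ∣ b ∸ a → a ≡ b mod M
∣∸⇒mod {M} {a} {b} a≤b (divides k b∸a≡kM) = k , 0 , (begin
  a + k * M     ≡⟨ cong (a +_) b∸a≡kM ⟨
  a + (b ∸ a)   ≡⟨ m+[n∸m]≡n a≤b ⟩
  b             ≡⟨ +-identityʳ b ⟨
  b + 0 * M     ∎)

mod-≤⇒offset : ∀ {M a b} → a ≡ b mod M → a ≤ b → ∃ λ s → b ≡ a + M * s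
mod-≤⇒offset {M} {a} {b} a≡b a≤b with mod-≤⇒∣∸ a≡b a≤b
... | divides s b∸a≡sM = s , (begin
  b           ≡⟨ m+[n∸m]≡n a≤b ⟨
  a + (b ∸ a) ≡⟨ cong (a +_) (trans b∸a≡sM (*-comm s M)) ⟩
  a + M * s   ∎)

-- Enumerations and cardinalities

length-cartesianProductWith : ∀ {A B C : Set} (f : A → B → C) xs ys →
  length (cartesianProductWith f xs ys) ≡ length xs * length ys
length-cartesianProductWith f []       ys = refl
length-cartesianProductWith f (x ∷ xs) ys = begin
  length (map (f x) ys ++ cartesianProductWith f xs ys)        ≡⟨ length-++ (map (f x) ys) ⟩
  length (map (f x) ys) + length (cartesianProductWith f xs ys)
    ≡⟨ cong₂ _+_ (length-map (f x) ys) (length-cartesianProductWith f xs ys) ⟩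
  length ys + length xs * length ys                             ∎

allVecs : ∀ m k → List (Vec (Fin m) k)
allVecs m zero    = [] ∷ []
allVecs m (suc k) = cartesianProductWith _∷_ (allFin m) (allVecs m k)

length-allVecs : ∀ m k → length (allVecs m k) ≡ m ^ k
length-allVecs m zero    = refl
length-allVecs m (suc k) = trans (length-cartesianProductWith _∷_ (allFin m) (allVecs m k))
  (cong₂ _*_ (length-tabulate {n = m} (λ i → i)) (length-allVecs m k))

allVecs-unique : ∀ m k → Unique (allVecs m k)
allVecs-unique m zero    = All.[] ∷ []
allVecs-unique m (suc k) = cartesianProductWith⁺ _∷_ Vecₚ.∷-injective (allFin⁺ m) (allVecs-unique m k)

∈-allVecs : ∀ {m k} (v : Vec (Fin m) k) → v ∈ allVecs m k
∈-allVecs []      = here refl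
∈-allVecs (x ∷ v) = ∈-cartesianProductWith⁺ _∷_ (∈-allFin x) (∈-allVecs v)

lookup-ext : ∀ {A : Set} {k} (u v : Vec A k) → (∀ i → lookup u i ≡ lookup v i) → u ≡ v
lookup-ext u v u≗v = begin
  u                   ≡⟨ Vecₚ.tabulate∘lookup u ⟨
  tabulate (lookup u) ≡⟨ Vecₚ.tabulate-cong u≗v ⟩
  tabulate (lookup v) ≡⟨ Vecₚ.tabulate∘lookup v ⟩
  v                   ∎

removeAt : ∀ {A : Set} {y : A} (ys : List A) → y ∈ ys → List A
removeAt (_ ∷ ys) (here _)  = ys
removeAt (w ∷ ys) (there y∈) = w ∷ removeAt ys y∈

length-removeAt : ∀ {A : Set} {y : A} (ys : List A) (y∈ : y ∈ ys) → length ys ≡ suc (length (removeAt ys y∈))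
length-removeAt (_ ∷ ys) (here _)  = refl
length-removeAt (w ∷ ys) (there y∈) = cong suc (length-removeAt ys y∈)

∈-removeAt : ∀ {A : Set} {y z : A} (ys : List A) (y∈ : y ∈ ys) → z ∈ ys → z ≢ y → z ∈ removeAt ys y∈
∈-removeAt (_ ∷ ys) (here y≡) (here z≡)  z≢y = ⊥-elim (z≢y (trans z≡ (sym y≡)))
∈-removeAt (_ ∷ ys) (here _)  (there z∈) _   = z∈
∈-removeAt (_ ∷ ys) (there _) (here z≡)  _   = here z≡
∈-removeAt (_ ∷ ys) (there y∈) (there z∈) z≢y = there (∈-removeAt ys y∈ z∈ z≢y)

length-≤-injection : ∀ {A B : Set} (xs : List A) (ys : List B) (g : A → B) → Unique xs →
  (∀ {a} → a ∈ xs → g a ∈ ys) → (∀ {a b} → a ∈ xs → b ∈ xs → g a ≡ g b → a ≡ b) →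
  length xs ≤ length ys
length-≤-injection []       ys g _           _    _   = z≤n
length-≤-injection (x ∷ xs) ys g (x∉xs ∷ xs!) into inj =
  subst (suc (length xs) ≤_) (sym (length-removeAt ys gx∈))
    (s≤s (length-≤-injection xs (removeAt ys gx∈) g xs!
      (λ a∈ → ∈-removeAt ys gx∈ (into (there a∈)) (ga≢gx a∈))
      (λ a∈ b∈ → inj (there a∈) (there b∈))))
  where
  gx∈ : g x ∈ ys
  gx∈ = into (here refl)
  ga≢gx : ∀ {a} → a ∈ xs → g a ≢ g x
  ga≢gx a∈ ga≡gx = All.lookup x∉xs a∈ (sym (inj (there a∈) (here refl) ga≡gx))

filter-hasCard : ∀ {A : Set} {P : A → Set} (P? : Decidable P) (xs : List A) → Unique xs → (∀ a → a ∈ xs) →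
  HasCard P (length (filter P? xs))
filter-hasCard P? xs xs! all∈ = filter P? xs , filter⁺ P? xs! , refl ,
  λ a → mk⇔ (λ a∈ → proj₂ (∈-filter⁻ P? {xs = xs} a∈)) (∈-filter⁺ P? (all∈ a))

hasCard-≤ : ∀ {A B : Set} {P : A → Set} {c} → HasCard P c → (g : A → B) →
  (∀ {a b} → P a → P b → g a ≡ g b → a ≡ b) → (ys : List B) → (∀ b → b ∈ ys) → c ≤ length ys
hasCard-≤ (xs , xs! , refl , ∈⇔P) g inj ys all∈ = length-≤-injection xs ys g xs! (λ {a} _ → all∈ (g a))
  (λ a∈ b∈ → inj (Equivalence.to (∈⇔P _) a∈) (Equivalence.to (∈⇔P _) b∈))

≤-hasCard : ∀ {A B : Set} {P : A → Set} {c} → HasCard P c → (xs : List B) → Unique xs → (g : B → A) →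
  (∀ x → P (g x)) → (∀ {x y} → g x ≡ g y → x ≡ y) → length xs ≤ c
≤-hasCard (ys , _ , refl , ∈⇔P) xs xs! g P∘g inj = length-≤-injection xs ys g xs!
  (λ {x} _ → Equivalence.from (∈⇔P (g x)) (P∘g x)) (λ _ _ → inj)

injective⇒surjective : ∀ {m} (h : Fin m → Fin m) → (∀ {a b} → h a ≡ h b → a ≡ b) →
  ∀ y → ∃ λ x → h x ≡ y
injective⇒surjective {suc m} h inj y with Finₚ.any? (λ x → h x Finₚ.≟ y)
... | yes hit = hit
... | no miss = ⊥-elim (<-irrefl refl (Finₚ.injective⇒≤ {f = h′} h′-injective))
  where
  y≢h : ∀ x → y ≢ h x
  y≢h x y≡hx = miss (x , sym y≡hx)
  h′ : Fin (suc m) → Fin m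
  h′ x = punchOut (y≢h x)
  h′-injective : ∀ {a b} → h′ a ≡ h′ b → a ≡ b
  h′-injective h′a≡h′b = inj (Finₚ.punchOut-injective (y≢h _) (y≢h _) h′a≡h′b)

cycPred : ∀ {k} → Fin k → Fin k
cycPred {suc k} Fin.zero    = fromℕ k
cycPred {suc k} (Fin.suc i) = inject₁ i

cycSucc-cycPred : ∀ {k} (j : Fin k) → CycSucc (cycPred j) j
cycSucc-cycPred {suc k} Fin.zero    = inj₂ (cong suc (Finₚ.toℕ-fromℕ k) , refl)
cycSucc-cycPred {suc k} (Fin.suc i) = inj₁ (cong suc (Finₚ.toℕ-inject₁ i))

cycSucc⇒cycPred : ∀ {k} {i j : Fin k} → CycSucc i j → i ≡ cycPred j
cycSucc⇒cycPred {suc k} {j = Fin.zero}  (inj₁ ())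
cycSucc⇒cycPred {suc k} {j = Fin.zero}  (inj₂ (1+i≡1+k , _)) =
  Finₚ.toℕ-injective (trans (suc-injective 1+i≡1+k) (sym (Finₚ.toℕ-fromℕ k)))
cycSucc⇒cycPred {suc k} {j = Fin.suc j} (inj₁ 1+i≡1+j) =
  Finₚ.toℕ-injective (trans (suc-injective 1+i≡1+j) (sym (Finₚ.toℕ-inject₁ j)))
cycSucc⇒cycPred {suc k} {j = Fin.suc j} (inj₂ (_ , ()))

-- Powers modulo a prime and their lifts

^≡1-*ʳ : ∀ {M w A} x → w ^ A ≡ 1 mod M → w ^ (A * x) ≡ 1 mod M
^≡1-*ʳ {M} {w} {A} x wᴬ≡1 =
  subst₂ (_≡_mod M) (^-*-assoc w A x) (^-zeroˡ x) (mod-^ x wᴬ≡1)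

^≡1-cancel : ∀ {M w d X} → w ^ X ≡ 1 mod M → w ^ (d + X) ≡ 1 mod M → w ^ d ≡ 1 mod M
^≡1-cancel {M} {w} {d} {X} wˣ≡1 wᵈ⁺ˣ≡1 = mod-trans (mod-trans
  (mod-reflexive (sym (*-identityʳ (w ^ d))))
  (mod-* (mod-refl (w ^ d)) (mod-sym wˣ≡1)))
  (subst (_≡ 1 mod M) (^-distribˡ-+-* w d X) wᵈ⁺ˣ≡1)

^≡1-bezout : ∀ {M w A B g} → w ^ A ≡ 1 mod M → w ^ B ≡ 1 mod M →
  Bézout.Identity g A B → w ^ g ≡ 1 mod M
^≡1-bezout {M} {w} {A} {B} {g} wᴬ≡1 wᴮ≡1 (Bézout.+- x y g+yB≡xA) =
  ^≡1-cancel {w = w} {d = g} {X = B * y} (^≡1-*ʳ {A = B} y wᴮ≡1)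
    (subst (λ e → w ^ e ≡ 1 mod M) (trans (*-comm A x) (trans (sym g+yB≡xA) (cong (g +_) (*-comm y B))))
      (^≡1-*ʳ {A = A} x wᴬ≡1))
^≡1-bezout {M} {w} {A} {B} {g} wᴬ≡1 wᴮ≡1 (Bézout.-+ x y g+xA≡yB) =
  ^≡1-cancel {w = w} {d = g} {X = A * x} (^≡1-*ʳ {A = A} x wᴬ≡1)
    (subst (λ e → w ^ e ≡ 1 mod M) (trans (*-comm B y) (trans (sym g+xA≡yB) (cong (g +_) (*-comm x A))))
      (^≡1-*ʳ {A = B} y wᴮ≡1))

binomial-expansion : ∀ x e → ∃ λ R → (1 + x) ^ e ≡ 1 + e * x + x * x * R
binomial-expansion x zero    = 0 , base x
  where
  base : ∀ x → 1 ≡ 1 + 0 * x + x * x * 0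
  base = solve-∀
binomial-expansion x (suc e) with R , eq ← binomial-expansion x e = e + R + R * x , (begin
  (1 + x) * (1 + x) ^ e                   ≡⟨ cong ((1 + x) *_) eq ⟩
  (1 + x) * (1 + e * x + x * x * R)       ≡⟨ step x e R ⟩
  1 + suc e * x + x * x * (e + R + R * x) ∎)
  where
  step : ∀ x e R → (1 + x) * (1 + e * x + x * x * R) ≡ 1 + suc e * x + x * x * (e + R + R * x)
  step = solve-∀

-- (1 + s M) ^ e = 1 + e s M + (s M)² R, and both error terms are multiples of M e.
^-lift-≡1 : ∀ {M w e} .{{_ : NonZero w}} → e ∣ M → w ≡ 1 mod M → w ^ e ≡ 1 mod M * e
^-lift-≡1 {M} {w} {e} (divides t refl) w≡1
  with s , w≡1+Ms ← mod-≤⇒offset (mod-sym w≡1) (>-nonZero⁻¹ w)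
  with R , expand ← binomial-expansion (t * e * s) e = 0 , s + s * s * t * R , (begin
    w ^ e + 0 * (t * e * e)                           ≡⟨ +-identityʳ (w ^ e) ⟩
    w ^ e                                             ≡⟨ cong (_^ e) w≡1+Ms ⟩
    (1 + t * e * s) ^ e                               ≡⟨ expand ⟩
    1 + e * (t * e * s) + t * e * s * (t * e * s) * R ≡⟨ collect t e s R ⟩
    1 + (s + s * s * t * R) * (t * e * e)             ∎)
  where
  collect : ∀ t e s R → 1 + e * (t * e * s) + t * e * s * (t * e * s) * R ≡ 1 + (s + s * s * t * R) * (t * e * e)
  collect = solve-∀

^-p^m-lift-≡1 : ∀ {p w} .{{_ : NonZero w}} → w ≡ 1 mod p → ∀ m → w ^ (p ^ m) ≡ 1 mod p ^ suc m
^-p^m-lift-≡1 {p} {w} w≡1 zero =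
  subst₂ (λ a M → a ≡ 1 mod M) (sym (^-identityʳ w)) (sym (*-identityʳ p)) w≡1
^-p^m-lift-≡1 {p} {w} w≡1 (suc m) = subst₂ (λ a M → a ≡ 1 mod M) power modulus
  (^-lift-≡1 {{m^n≢0 w (p ^ m)}} (m∣m*n {p} (p ^ m)) (^-p^m-lift-≡1 w≡1 m))
  where
  power : (w ^ (p ^ m)) ^ p ≡ w ^ (p * p ^ m)
  power = trans (^-*-assoc w (p ^ m) p) (cong (w ^_) (*-comm (p ^ m) p))
  modulus : p ^ suc m * p ≡ p ^ suc (suc m)
  modulus = *-comm (p ^ suc m) p

coprime-^ʳ : ∀ {d p} → Coprime d p → ∀ m → Coprime d (p ^ m)
coprime-^ʳ d⊥p zero    (_ , i∣1)       = ∣1⇒≡1 i∣1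
coprime-^ʳ {d} {p} d⊥p (suc m) {i} (i∣d , i∣pp) = coprime-^ʳ d⊥p m (i∣d , coprime-divisor i⊥p i∣pp)
  where
  i⊥p : Coprime i p
  i⊥p (j∣i , j∣p) = d⊥p (∣-trans j∣i i∣d , j∣p)

¬∣⇒nonZero : ∀ {d x} → ¬ d ∣ x → NonZero x
¬∣⇒nonZero {d} {zero}  d∤0 = ⊥-elim (d∤0 (d ∣0))
¬∣⇒nonZero {d} {suc x} _   = _

module _ {p : ℕ} (pr : Prime p) where

  private instance
    p≢0 : NonZero p
    p≢0 = prime⇒nonZero pr

  1<p : 1 < p
  1<p = nonTrivial⇒n>1 p {{prime⇒nonTrivial pr}}

  p∸1<p : p ∸ 1 < p
  p∸1<p = ∸-monoʳ-< (s≤s z≤n) (<⇒≤ 1<p)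

  ¬∣-^ : ∀ {w} → ¬ p ∣ w → ∀ a → ¬ p ∣ w ^ a
  ¬∣-^ p∤w zero    p∣1 = <⇒≢ 1<p (sym (∣1⇒≡1 p∣1))
  ¬∣-^ {w} p∤w (suc a) p∣wᵃ⁺¹ with euclidsLemma w (w ^ a) pr p∣wᵃ⁺¹
  ... | inj₁ p∣w  = p∤w p∣w
  ... | inj₂ p∣wᵃ = ¬∣-^ p∤w a p∣wᵃ

  mod-≤-cancelˡ : ∀ {u a b} → ¬ p ∣ u → a ≤ b → u * a ≡ u * b mod p → p ∣ b ∸ a
  mod-≤-cancelˡ {u} {a} {b} p∤u a≤b ua≡ub with euclidsLemma u (b ∸ a) pr
    (subst (p ∣_) (sym (*-distribˡ-∸ u b a)) (mod-≤⇒∣∸ ua≡ub (*-monoʳ-≤ u a≤b)))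
  ... | inj₁ p∣u   = ⊥-elim (p∤u p∣u)
  ... | inj₂ p∣b∸a = p∣b∸a

  mod-cancelˡ : ∀ {u x y} → ¬ p ∣ u → u * x ≡ u * y mod p → x ≡ y mod p
  mod-cancelˡ {u} {x} {y} p∤u ux≡uy with ≤-total x y
  ... | inj₁ x≤y = ∣∸⇒mod x≤y (mod-≤-cancelˡ p∤u x≤y ux≡uy)
  ... | inj₂ y≤x = mod-sym (∣∸⇒mod y≤x (mod-≤-cancelˡ p∤u y≤x (mod-sym ux≡uy)))

  -- The nonzero residue x % p, shifted down to Fin (p ∸ 1); for p ∣ x it is junk (0).
  residue⁺ : ℕ → Fin (p ∸ 1)
  residue⁺ x = fromℕ< (bound (x % p) (m%n<n x p))
    where
    bound : ∀ r → r < p → r ∸ 1 < p ∸ 1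
    bound zero    _   = m<n⇒0<n∸m 1<p
    bound (suc r) r<p = ∸-monoˡ-< r<p (s≤s z≤n)

  toℕ-residue⁺ : ∀ x → toℕ (residue⁺ x) ≡ x % p ∸ 1
  toℕ-residue⁺ x = Finₚ.toℕ-fromℕ< _

  residue⁺-cong : ∀ {x y} → x % p ≡ y % p → residue⁺ x ≡ residue⁺ y
  residue⁺-cong {x} {y} x%≡y% = Finₚ.toℕ-injective (begin
    toℕ (residue⁺ x) ≡⟨ toℕ-residue⁺ x ⟩
    x % p ∸ 1        ≡⟨ cong (_∸ 1) x%≡y% ⟩
    y % p ∸ 1        ≡⟨ toℕ-residue⁺ y ⟨
    toℕ (residue⁺ y) ∎)

  ¬∣⇒1≤% : ∀ {x} → ¬ p ∣ x → 1 ≤ x % p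
  ¬∣⇒1≤% {x} p∤x with x % p in x%p≡r
  ... | zero  = ⊥-elim (p∤x (m%n≡0⇒n∣m x p x%p≡r))
  ... | suc _ = s≤s z≤n

  residue⁺-injective : ∀ {x y} → ¬ p ∣ x → ¬ p ∣ y → residue⁺ x ≡ residue⁺ y → x ≡ y mod p
  residue⁺-injective {x} {y} p∤x p∤y r≡r =
    %≡⇒mod (∸-cancelʳ-≡ (¬∣⇒1≤% p∤x) (¬∣⇒1≤% p∤y) (begin
      x % p ∸ 1        ≡⟨ toℕ-residue⁺ x ⟨
      toℕ (residue⁺ x) ≡⟨ cong toℕ r≡r ⟩
      toℕ (residue⁺ y) ≡⟨ toℕ-residue⁺ y ⟩
      y % p ∸ 1        ∎))

  ^-cancel : ∀ {w} a D → ¬ p ∣ w → w ^ a ≡ w ^ (a + D) mod p → w ^ D ≡ 1 mod p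
  ^-cancel {w} a D p∤w wᵃ≡wᵃ⁺ᴰ = mod-sym (mod-cancelˡ (¬∣-^ p∤w a)
    (subst₂ (_≡_mod p) (sym (*-identityʳ (w ^ a))) (^-distribˡ-+-* w a D) wᵃ≡wᵃ⁺ᴰ))

  unit-order : ∀ {w} → ¬ p ∣ w → ∃ λ d → 0 < d × d < p × w ^ d ≡ 1 mod p
  unit-order {w} p∤w
    with i , j , i<j , same ← Finₚ.pigeonhole p∸1<p (λ i → residue⁺ (w ^ toℕ i))
    = toℕ j ∸ toℕ i , m<n⇒0<n∸m i<j , ≤-<-trans (m∸n≤m (toℕ j) (toℕ i)) (Finₚ.toℕ<n j) ,
      ^-cancel (toℕ i) (toℕ j ∸ toℕ i) p∤w
        (subst (λ e → w ^ toℕ i ≡ w ^ e mod p) (sym (m+[n∸m]≡n (<⇒≤ i<j)))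
          (residue⁺-injective (¬∣-^ p∤w (toℕ i)) (¬∣-^ p∤w (toℕ j)) same))

  ^p^m≡1⇒≡1 : ∀ {w} m → ¬ p ∣ w → w ^ (p ^ m) ≡ 1 mod p → w ≡ 1 mod p
  ^p^m≡1⇒≡1 {w} m p∤w w^p^m≡1 with d , 0<d , d<p , wᵈ≡1 ← unit-order p∤w =
    subst (_≡ 1 mod p) (^-identityʳ w)
      (^≡1-bezout {A = d} {B = p ^ m} wᵈ≡1 w^p^m≡1 (coprime-Bézout (coprime-^ʳ d⊥p m)))
    where
    d⊥p : Coprime d p
    d⊥p = Coprimality.sym (prime⇒coprime pr {{>-nonZero 0<d}} d<p)

  -- The hypothesis says (Q^s)^(p^m) ≡ 1 (mod p); hence Q^s ≡ 1 (mod p), and raising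
  -- to the power p^m upgrades this to the modulus p^(m+1).
  ^-lift-offset : ∀ {Q} m y s → ¬ p ∣ Q → Q ^ y ≡ Q ^ (y + p ^ m * s) mod p →
    Q ^ y ≡ Q ^ (y + p ^ m * s) mod p ^ suc m
  ^-lift-offset {Q} m y s p∤Q same = mod-trans (mod-reflexive (sym (*-identityʳ (Q ^ y))))
    (subst (Q ^ y * 1 ≡_mod p ^ suc m) (sym split) (mod-* (mod-refl (Q ^ y)) (mod-sym lifted)))
    where
    split : Q ^ (y + p ^ m * s) ≡ Q ^ y * (Q ^ s) ^ (p ^ m)
    split = begin
      Q ^ (y + p ^ m * s)       ≡⟨ ^-distribˡ-+-* Q y (p ^ m * s) ⟩
      Q ^ y * Q ^ (p ^ m * s)   ≡⟨ cong (λ e → Q ^ y * Q ^ e) (*-comm (p ^ m) s) ⟩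
      Q ^ y * Q ^ (s * p ^ m)   ≡⟨ cong (Q ^ y *_) (^-*-assoc Q s (p ^ m)) ⟨
      Q ^ y * (Q ^ s) ^ (p ^ m) ∎
    p∤Qˢ : ¬ p ∣ Q ^ s
    p∤Qˢ = ¬∣-^ p∤Q s
    Qˢ≡1 : Q ^ s ≡ 1 mod p
    Qˢ≡1 = ^p^m≡1⇒≡1 m p∤Qˢ
      (subst (_≡ 1 mod p) (trans (cong (Q ^_) (*-comm (p ^ m) s)) (sym (^-*-assoc Q s (p ^ m))))
        (^-cancel y (p ^ m * s) p∤Q same))
    lifted : (Q ^ s) ^ (p ^ m) ≡ 1 mod p ^ suc m
    lifted = ^-p^m-lift-≡1 {{¬∣⇒nonZero p∤Qˢ}} Qˢ≡1 m

  ^-lift : ∀ {Q y y′} m → ¬ p ∣ Q → y ≡ y′ mod p ^ m → Q ^ y ≡ Q ^ y′ mod p →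
    Q ^ y ≡ Q ^ y′ mod p ^ suc m
  ^-lift {Q} {y} {y′} m p∤Q y≡y′ same with ≤-total y y′
  ... | inj₁ y≤y′ with s , refl ← mod-≤⇒offset y≡y′ y≤y′ = ^-lift-offset m y s p∤Q same
  ... | inj₂ y′≤y with s , refl ← mod-≤⇒offset (mod-sym y≡y′) y′≤y =
    mod-sym (^-lift-offset m y′ s p∤Q (mod-sym same))

  unit-period : ∀ {w} → ¬ p ∣ w → ∀ m → ∃ λ P → 0 < P × w ^ P ≡ 1 mod p ^ suc m
  unit-period {w} p∤w m with d , 0<d , _ , wᵈ≡1 ← unit-order p∤w =
    d * p ^ m , *-mono-≤ 0<d (m^n>0 p m) ,
    subst (_≡ 1 mod p ^ suc m) (^-*-assoc w d (p ^ m))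
      (^-p^m-lift-≡1 {{¬∣⇒nonZero (¬∣-^ p∤w d)}} wᵈ≡1 m)

-- Integer powers modulo N

pos-+-* : ∀ a b c → ℤ.+ a +ℤ ℤ.+ b *ℤ ℤ.+ c ≡ ℤ.+ (a + b * c)
pos-+-* a b c = trans (cong (ℤ.+ a +ℤ_) (sym (ℤₚ.pos-* b c))) (sym (ℤₚ.pos-+ a (b * c)))

move-multiple : ∀ x y e d → x ≡ y +ℤ e *ℤ d → y ≡ x +ℤ (-ℤ e) *ℤ d
move-multiple x y e d x≡ = trans (cancel y e d) (cong (_+ℤ (-ℤ e) *ℤ d) (sym x≡))
  where
  cancel : ∀ y e d → y ≡ (y +ℤ e *ℤ d) +ℤ (-ℤ e) *ℤ d
  cancel = ℤ-Solver.solve-∀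

remainder-unique : ∀ {r r′ d} e → r < d → r′ < d → ℤ.+ r ≡ ℤ.+ r′ +ℤ e *ℤ ℤ.+ d → r ≡ r′
remainder-unique {r} {r′} {d} (ℤ.+ 0)    _   _    r≡ =
  ℤₚ.+-injective (trans r≡ (trans (pos-+-* r′ 0 d) (cong ℤ.+_ (+-identityʳ r′))))
remainder-unique {r} {r′} {d} ℤ.+[1+ m ] r<d _    r≡ = ⊥-elim (<⇒≱ r<d (multiple≤ r≡))
  where
  multiple≤ : ℤ.+ r ≡ ℤ.+ r′ +ℤ ℤ.+[1+ m ] *ℤ ℤ.+ d → d ≤ r
  multiple≤ r≡ = ≤-trans (m≤m+n d (m * d)) (≤-trans (m≤n+m (suc m * d) r′)
    (≤-reflexive (sym (ℤₚ.+-injective (trans r≡ (pos-+-* r′ (suc m) d))))))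
remainder-unique {r} {r′} {d} ℤ.-[1+ m ] r<d r′<d r≡ =
  sym (remainder-unique ℤ.+[1+ m ] r′<d r<d (move-multiple (ℤ.+ r) (ℤ.+ r′) ℤ.-[1+ m ] (ℤ.+ d) r≡))

%ℕ-unique : ∀ a d .{{_ : NonZero d}} r k → r < d → a ≡ ℤ.+ r +ℤ k *ℤ ℤ.+ d → a %ℕ d ≡ r
%ℕ-unique a d r k r<d a≡ = remainder-unique (k -ℤ a /ℕ d) (n%ℕd<d a d) r<d (begin
  ℤ.+ (a %ℕ d)
    ≡⟨ move-multiple a (ℤ.+ (a %ℕ d)) (a /ℕ d) (ℤ.+ d) (a≡a%ℕn+[a/ℕn]*n a d) ⟩
  a +ℤ (-ℤ (a /ℕ d)) *ℤ ℤ.+ d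
    ≡⟨ cong (_+ℤ (-ℤ (a /ℕ d)) *ℤ ℤ.+ d) a≡ ⟩
  ℤ.+ r +ℤ k *ℤ ℤ.+ d +ℤ (-ℤ (a /ℕ d)) *ℤ ℤ.+ d
    ≡⟨ collect (ℤ.+ r) k (a /ℕ d) (ℤ.+ d) ⟩
  ℤ.+ r +ℤ (k -ℤ a /ℕ d) *ℤ ℤ.+ d ∎)
  where
  collect : ∀ r k k′ d → r +ℤ k *ℤ d +ℤ (-ℤ k′) *ℤ d ≡ r +ℤ (k -ℤ k′) *ℤ d
  collect = ℤ-Solver.solve-∀

^-congruent : ∀ {q Q c N} → q ≡ ℤ.+ Q +ℤ c *ℤ ℤ.+ N → ∀ y →
  ∃ λ c′ → q ^ℤ y ≡ ℤ.+ (Q ^ y) +ℤ c′ *ℤ ℤ.+ N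
^-congruent {q} {Q} {c} {N} q≡ zero    = ℤ.+ 0 , sym (pos-+-* 1 0 N)
^-congruent {q} {Q} {c} {N} q≡ (suc y) with c′ , qʸ≡ ← ^-congruent {c = c} q≡ y = c″ , (begin
  q *ℤ q ^ℤ y
    ≡⟨ cong₂ _*ℤ_ q≡ qʸ≡ ⟩
  (ℤ.+ Q +ℤ c *ℤ ℤ.+ N) *ℤ (ℤ.+ (Q ^ y) +ℤ c′ *ℤ ℤ.+ N)
    ≡⟨ expand (ℤ.+ Q) c (ℤ.+ (Q ^ y)) c′ (ℤ.+ N) ⟩
  ℤ.+ Q *ℤ ℤ.+ (Q ^ y) +ℤ c″ *ℤ ℤ.+ N
    ≡⟨ cong (_+ℤ c″ *ℤ ℤ.+ N) (ℤₚ.pos-* Q (Q ^ y)) ⟨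
  ℤ.+ (Q * Q ^ y) +ℤ c″ *ℤ ℤ.+ N ∎)
  where
  c″ : ℤ
  c″ = c *ℤ ℤ.+ (Q ^ y) +ℤ ℤ.+ Q *ℤ c′ +ℤ c *ℤ c′ *ℤ ℤ.+ N
  expand : ∀ Q c Qʸ c′ N →
    (Q +ℤ c *ℤ N) *ℤ (Qʸ +ℤ c′ *ℤ N) ≡ Q *ℤ Qʸ +ℤ (c *ℤ Qʸ +ℤ Q *ℤ c′ +ℤ c *ℤ c′ *ℤ N) *ℤ N
  expand = ℤ-Solver.solve-∀

%ℕ-^ : ∀ q {N d} .{{_ : NonZero N}} .{{_ : NonZero d}} → d ∣ N → ∀ y →
  (q ^ℤ y) %ℕ d ≡ ((q %ℕ N) ^ y) % d
%ℕ-^ q {N} {d} (divides e refl) y with c′ , qʸ≡ ← ^-congruent {c = q /ℕ N} (a≡a%ℕn+[a/ℕn]*n q N) y =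
  %ℕ-unique (q ^ℤ y) d R (ℤ.+ K +ℤ c′ *ℤ ℤ.+ e) (m%n<n Qʸ d) (begin
    q ^ℤ y
      ≡⟨ qʸ≡ ⟩
    ℤ.+ Qʸ +ℤ c′ *ℤ ℤ.+ (e * d)
      ≡⟨ cong₂ (λ a b → a +ℤ c′ *ℤ b) (cong ℤ.+_ (m≡m%n+[m/n]*n Qʸ d)) (ℤₚ.pos-* e d) ⟩
    ℤ.+ (R + K * d) +ℤ c′ *ℤ (ℤ.+ e *ℤ ℤ.+ d)
      ≡⟨ cong (_+ℤ c′ *ℤ (ℤ.+ e *ℤ ℤ.+ d)) (pos-+-* R K d) ⟨
    ℤ.+ R +ℤ ℤ.+ K *ℤ ℤ.+ d +ℤ c′ *ℤ (ℤ.+ e *ℤ ℤ.+ d)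
      ≡⟨ collect (ℤ.+ R) (ℤ.+ K) c′ (ℤ.+ e) (ℤ.+ d) ⟩
    ℤ.+ R +ℤ (ℤ.+ K +ℤ c′ *ℤ ℤ.+ e) *ℤ ℤ.+ d ∎)
  where
  Qʸ R K : ℕ
  Qʸ = (q %ℕ (e * d)) ^ y
  R = Qʸ % d
  K = Qʸ / d
  collect : ∀ R K c′ e d → R +ℤ K *ℤ d +ℤ c′ *ℤ (e *ℤ d) ≡ R +ℤ (K +ℤ c′ *ℤ e) *ℤ d
  collect = ℤ-Solver.solve-∀

¬∣-%ℕ : ∀ {p N} q .{{_ : NonZero N}} → 1 < p → Coprime ∣ q ∣ p → p ∣ N → ¬ p ∣ q %ℕ N
¬∣-%ℕ {p} {N} q 1<p q⊥p p∣N p∣q%N = <⇒≢ 1<p (sym (q⊥p (ℤ∣.∣⇒∣ᵤ p∣q , ∣-refl)))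
  where
  p∣q : ℤ.+ p ℤ∣.∣ q
  p∣q = subst (ℤ.+ p ℤ∣.∣_) (sym (a≡a%ℕn+[a/ℕn]*n q N))
    (ℤ∣.∣m∣n⇒∣m+n (ℤ∣.∣ᵤ⇒∣ {i = ℤ.+ (q %ℕ N)} p∣q%N)
      (ℤ∣.∣n⇒∣m*n (q /ℕ N) (ℤ∣.∣ᵤ⇒∣ {i = ℤ.+ N} p∣N)))

-- The graph Γ_{p,n,q}

^-monoʳ-∣ : ∀ p {m n} → m ≤ n → p ^ m ∣ p ^ n
^-monoʳ-∣ p {m} {n} m≤n = subst (p ^ m ∣_)
  (trans (sym (^-distribˡ-+-* p m (n ∸ m))) (cong (p ^_) (m+[n∸m]≡n m≤n)))
  (m∣m*n (p ^ (n ∸ m)))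

p∣p^n : ∀ {p n} → 1 ≤ n → p ∣ p ^ n
p∣p^n {p} {n} 1≤n = subst (_∣ p ^ n) (*-identityʳ p) (^-monoʳ-∣ p 1≤n)

module PowerMap {p : ℕ} (pr : Prime p) (n : ℕ) (1≤n : 1 ≤ n) (Q : ℕ) (p∤Q : ¬ p ∣ Q) where

  N : ℕ
  N = p ^ n

  private instance
    p≢0 : NonZero p
    p≢0 = prime⇒nonZero pr
    N≢0 : NonZero N
    N≢0 = m^n≢0 p n

  power : ℕ → ℕ
  power y = Q ^ y % N

  mod-N⇒mod-p^ : ∀ {a b} m → m ≤ n → a ≡ b mod N → a ≡ b mod p ^ m
  mod-N⇒mod-p^ m m≤n = mod-∣ (^-monoʳ-∣ p m≤n)

  power%p : ∀ y → power y % p ≡ Q ^ y % p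
  power%p y = m∣n⇒o%n%m≡o%m p N (Q ^ y) (p∣p^n 1≤n)

  ¬∣-power : ∀ y → ¬ p ∣ power y
  ¬∣-power y p∣power = ¬∣-^ pr p∤Q y
    (m%n≡0⇒n∣m (Q ^ y) p (trans (sym (power%p y)) (n∣m⇒m%n≡0 (power y) p p∣power)))

  power-lift : ∀ {y y′} m → suc m ≤ n → y ≡ y′ mod p ^ m → power y % p ≡ power y′ % p →
    power y ≡ power y′ mod p ^ suc m
  power-lift {y} {y′} m m<n y≡y′ same = mod-trans (mod-N⇒mod-p^ (suc m) m<n (%-mod N (Q ^ y)))
    (mod-trans (^-lift pr m p∤Q y≡y′ (%≡⇒mod (trans (sym (power%p y)) (trans same (power%p y′)))))
      (mod-sym (mod-N⇒mod-p^ (suc m) m<n (%-mod N (Q ^ y′)))))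

  Arrow : ℕ → ℕ → Set
  Arrow a b = ∃ λ y → y % N ≡ a × power y ≡ b

  IsCycleℕ : ∀ {k} → (Fin k → ℕ) → Set
  IsCycleℕ c = ∀ j → Arrow (c (cycPred j)) (c j)

  IsCycleℕ-cong : ∀ {k} {c c′ : Fin k → ℕ} → (∀ i → c i ≡ c′ i) → IsCycleℕ c → IsCycleℕ c′
  IsCycleℕ-cong c≗c′ cyc j = subst₂ Arrow (c≗c′ (cycPred j)) (c≗c′ j) (cyc j)

  ¬∣-cycle : ∀ {k} {c : Fin k → ℕ} → IsCycleℕ c → ∀ j → ¬ p ∣ c j
  ¬∣-cycle cyc j p∣cj with y , _ , power≡ ← cyc j = ¬∣-power y (subst (p ∣_) (sym power≡) p∣cj)

  cycles-agree-mod-p^ : ∀ {k} {c c′ : Fin k → ℕ} → IsCycleℕ c → IsCycleℕ c′ →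
    (∀ i → c i ≡ c′ i mod p) → ∀ m → m ≤ n → ∀ i → c i ≡ c′ i mod p ^ m
  cycles-agree-mod-p^ cyc cyc′ agree zero    _   i = mod-1 _ _
  cycles-agree-mod-p^ cyc cyc′ agree (suc m) m<n j
    with y , y%N≡ , power≡ ← cyc j | y′ , y′%N≡ , power≡′ ← cyc′ j =
    subst₂ (_≡_mod p ^ suc m) power≡ power≡′
      (power-lift m m<n y≡y′ (mod⇒%≡ (subst₂ (_≡_mod p) (sym power≡) (sym power≡′) (agree j))))
    where
    m≤n : m ≤ n
    m≤n = ≤-trans (n≤1+n m) m<n
    y≡y′ : y ≡ y′ mod p ^ m
    y≡y′ = mod-trans (mod-sym (mod-N⇒mod-p^ m m≤n (subst (_≡ y mod N) y%N≡ (%-mod N y))))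
      (mod-trans (cycles-agree-mod-p^ cyc cyc′ agree m m≤n (cycPred j))
        (mod-N⇒mod-p^ m m≤n (subst (_≡ y′ mod N) y′%N≡ (%-mod N y′))))

  cycle-determined-by-residues : ∀ {k} {c c′ : Fin k → ℕ} → IsCycleℕ c → IsCycleℕ c′ →
    (∀ i → c i < N) → (∀ i → c′ i < N) → (∀ i → c i ≡ c′ i mod p) → ∀ i → c i ≡ c′ i
  cycle-determined-by-residues cyc cyc′ c<N c′<N agree i =
    mod⇒≡ (c<N i) (c′<N i) (cycles-agree-mod-p^ cyc cyc′ agree n ≤-refl i)

  period : ∃ λ P → 0 < P × Q ^ P ≡ 1 mod N
  period with P , 0<P , Qᴾ≡1 ← unit-period pr p∤Q (n ∸ 1) =
    P , 0<P , subst (λ e → Q ^ P ≡ 1 mod p ^ e) (m+[n∸m]≡n 1≤n) Qᴾ≡1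

  -- A common period of y ↦ y % N and of power.
  L : ℕ
  L = proj₁ period * N

  private instance
    L≢0 : NonZero L
    L≢0 = >-nonZero (*-mono-≤ (proj₁ (proj₂ period)) (m^n>0 p n))

  power-periodic : ∀ a b → power (a + b * L) ≡ power a
  power-periodic a b = mod⇒%≡ (subst₂ (_≡_mod N) (sym split) (*-identityʳ (Q ^ a))
    (mod-* (mod-refl (Q ^ a)) (^≡1-*ʳ {w = Q} {A = P} (N * b) (proj₂ (proj₂ period)))))
    where
    P : ℕ
    P = proj₁ period
    split : Q ^ (a + b * L) ≡ Q ^ a * Q ^ (P * (N * b))
    split = trans (cong (λ e → Q ^ (a + e)) (regroup b P N)) (^-distribˡ-+-* Q a (P * (N * b)))
      where
      regroup : ∀ b P N → b * (P * N) ≡ P * (N * b)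
      regroup = solve-∀

  arrow? : ∀ a b → Dec (Arrow a b)
  arrow? a b = map′ (λ (i , i%N≡a , power≡b) → toℕ i , i%N≡a , power≡b) reduce
    (Finₚ.any? λ i → (toℕ i % N ≟ a) ×-dec (power (toℕ i) ≟ b))
    where
    reduce : Arrow a b → ∃ λ (i : Fin L) → toℕ i % N ≡ a × power (toℕ i) ≡ b
    reduce (y , y%N≡a , power≡b) = fromℕ< y%L<L ,
      subst (λ z → z % N ≡ a) (sym (Finₚ.toℕ-fromℕ< y%L<L))
        (trans (m∣n⇒o%n%m≡o%m N L y (n∣m*n (proj₁ period))) y%N≡a) ,
      subst (λ z → power z ≡ b) (sym (Finₚ.toℕ-fromℕ< y%L<L))
        (trans (sym (power-periodic (y % L) (y / L))) (trans (cong power (sym (m≡m%n+[m/n]*n y L))) power≡b))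
      where
      y%L<L : y % L < L
      y%L<L = m%n<n y L

  module Primitive (Qᵖ⁻¹≡1 : Q ^ (p ∸ 1) ≡ 1 mod p)
                   (Qʲ≢1 : ∀ j → 0 < j → j < p ∸ 1 → ¬ Q ^ j ≡ 1 mod p) where

    private instance
      p∸1≢0 : NonZero (p ∸ 1)
      p∸1≢0 = >-nonZero (m<n⇒0<n∸m (1<p pr))

    -- g = gcd (D N, p ∸ 1) is prime to N, so it divides D; and Q ^ g ≡ 1 by Bézout.
    ¬^*N≡1 : ∀ {D} → 0 < D → D < p ∸ 1 → ¬ Q ^ (D * N) ≡ 1 mod p
    ¬^*N≡1 {D} 0<D D<p∸1 Q^DN≡1 with Bézout.lemma (D * N) (p ∸ 1)
    ... | Bézout.result g gcd identity = Qʲ≢1 g 0<g g<p∸1 (^≡1-bezout Q^DN≡1 Qᵖ⁻¹≡1 identity)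
      where
      g∣p∸1 : g ∣ p ∸ 1
      g∣p∸1 = proj₂ (GCD.commonDivisor gcd)
      0<g : 0 < g
      0<g = n≢0⇒n>0 (λ { refl → ≢-nonZero⁻¹ (p ∸ 1) (0∣⇒≡0 g∣p∸1) })
      g⊥N : Coprime g N
      g⊥N = coprime-^ʳ
        (Coprimality.sym (prime⇒coprime pr {{>-nonZero 0<g}} (≤-<-trans (∣⇒≤ g∣p∸1) (p∸1<p pr)))) n
      g∣D : g ∣ D
      g∣D = coprime-divisor g⊥N (subst (g ∣_) (*-comm D N) (proj₁ (GCD.commonDivisor gcd)))
      g<p∸1 : g < p ∸ 1
      g<p∸1 = ≤-<-trans (∣⇒≤ {{>-nonZero 0<D}} g∣D) D<p∸1

    ¬shift-collision : ∀ a {t t′} → t < t′ → t′ < p ∸ 1 → ¬ Q ^ (a + t * N) ≡ Q ^ (a + t′ * N) mod p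
    ¬shift-collision a {t} {t′} t<t′ t′<p∸1 collision =
      ¬^*N≡1 (m<n⇒0<n∸m t<t′) (≤-<-trans (m∸n≤m t′ t) t′<p∸1)
        (^-cancel pr (a + t * N) ((t′ ∸ t) * N) p∤Q
          (subst (λ e → Q ^ (a + t * N) ≡ Q ^ e mod p) shift collision))
      where
      shift : a + t′ * N ≡ a + t * N + (t′ ∸ t) * N
      shift = begin
        a + t′ * N                 ≡⟨ cong (λ s → a + s * N) (m+[n∸m]≡n (<⇒≤ t<t′)) ⟨
        a + (t + (t′ ∸ t)) * N     ≡⟨ cong (a +_) (*-distribʳ-+ N t (t′ ∸ t)) ⟩
        a + (t * N + (t′ ∸ t) * N) ≡⟨ +-assoc a (t * N) ((t′ ∸ t) * N) ⟨
        a + t * N + (t′ ∸ t) * N   ∎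

    shifted-residue : ℕ → Fin (p ∸ 1) → Fin (p ∸ 1)
    shifted-residue a t = residue⁺ pr (Q ^ (a + toℕ t * N))

    residue⁺-^-injective : ∀ s s′ → residue⁺ pr (Q ^ s) ≡ residue⁺ pr (Q ^ s′) → Q ^ s ≡ Q ^ s′ mod p
    residue⁺-^-injective s s′ = residue⁺-injective pr (¬∣-^ pr p∤Q s) (¬∣-^ pr p∤Q s′)

    shifted-residue-injective : ∀ a {t t′} → shifted-residue a t ≡ shifted-residue a t′ → t ≡ t′
    shifted-residue-injective a {t} {t′} same with <-cmp (toℕ t) (toℕ t′)
    ... | tri< t<t′ _ _ = ⊥-elim (¬shift-collision a t<t′ (Finₚ.toℕ<n t′)
      (residue⁺-^-injective (a + toℕ t * N) (a + toℕ t′ * N) same))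
    ... | tri≈ _ t≡t′ _ = Finₚ.toℕ-injective t≡t′
    ... | tri> _ _ t′<t = ⊥-elim (¬shift-collision a t′<t (Finₚ.toℕ<n t)
      (residue⁺-^-injective (a + toℕ t′ * N) (a + toℕ t * N) (sym same)))

    shifted-residue-surjective : ∀ a r → ∃ λ t → residue⁺ pr (Q ^ (a + t * N)) ≡ r
    shifted-residue-surjective a r
      with t , hit ← injective⇒surjective (shifted-residue a) (shifted-residue-injective a) r = toℕ t , hit

    -- The cycle with prescribed residues is the fixed point of `next`, reached by n iterations
    -- because `next` gains one p-adic digit of agreement at every step.
    module CycleWithResidues {k} (r : Fin k → Fin (p ∸ 1)) where

      shift : (Fin k → ℕ) → Fin k → ℕ
      shift x j = proj₁ (shifted-residue-surjective (x (cycPred j)) (r j))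

      exponent : (Fin k → ℕ) → Fin k → ℕ
      exponent x j = x (cycPred j) + shift x j * N

      next : (Fin k → ℕ) → Fin k → ℕ
      next x j = power (exponent x j)

      exponent-mod : ∀ x j → exponent x j ≡ x (cycPred j) mod N
      exponent-mod x j = 0 , shift x j , +-identityʳ (exponent x j)

      residue⁺-next : ∀ x j → residue⁺ pr (next x j) ≡ r j
      residue⁺-next x j = trans (residue⁺-cong pr (power%p (exponent x j)))
        (proj₂ (shifted-residue-surjective (x (cycPred j)) (r j)))

      next-contracts : ∀ m → suc m ≤ n → ∀ {x x′} → (∀ i → x i ≡ x′ i mod p ^ m) →
        ∀ j → next x j ≡ next x′ j mod p ^ suc m
      next-contracts m m<n {x} {x′} x≡x′ j = power-lift m m<n exponents
        (mod⇒%≡ (residue⁺-injective pr (¬∣-power (exponent x j)) (¬∣-power (exponent x′ j))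
          (trans (residue⁺-next x j) (sym (residue⁺-next x′ j)))))
        where
        m≤n : m ≤ n
        m≤n = ≤-trans (n≤1+n m) m<n
        exponents : exponent x j ≡ exponent x′ j mod p ^ m
        exponents = mod-trans (mod-N⇒mod-p^ m m≤n (exponent-mod x j))
          (mod-trans (x≡x′ (cycPred j)) (mod-sym (mod-N⇒mod-p^ m m≤n (exponent-mod x′ j))))

      approx : ℕ → Fin k → ℕ
      approx zero    _ = 0
      approx (suc m)   = next (approx m)

      approx<N : ∀ m i → approx m i < N
      approx<N zero    i = >-nonZero⁻¹ N
      approx<N (suc m) i = m%n<n _ N

      approx-converges : ∀ m → m ≤ n → ∀ i → approx m i ≡ approx (suc m) i mod p ^ m
      approx-converges zero    _   i = mod-1 _ _
      approx-converges (suc m) m<n   = next-contracts m m<n (approx-converges m (≤-trans (n≤1+n m) m<n))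

      cycle : Fin k → ℕ
      cycle = approx n

      cycle-fixed : ∀ i → cycle i ≡ next cycle i
      cycle-fixed i = mod⇒≡ (approx<N n i) (approx<N (suc n) i) (approx-converges n ≤-refl i)

      cycle-isCycle : IsCycleℕ cycle
      cycle-isCycle j = exponent cycle j ,
        trans ([m+kn]%n≡m%n (cycle (cycPred j)) (shift cycle j) N) (m<n⇒m%n≡m (approx<N n (cycPred j))) ,
        sym (cycle-fixed j)

      residue⁺-cycle : ∀ j → residue⁺ pr (cycle j) ≡ r j
      residue⁺-cycle j = trans (cong (residue⁺ pr) (cycle-fixed j)) (residue⁺-next cycle j)

module CycleCount {p : ℕ} (pr : Prime p) (n k : ℕ) (q : ℤ) (1≤n : 1 ≤ n) (q⊥p : Coprime ∣ q ∣ p) where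

  private instance
    p≢0 : NonZero p
    p≢0 = prime⇒nonZero pr
    N≢0 : NonZero (p ^ n)
    N≢0 = m^n≢0 p n

  Q : ℕ
  Q = q %ℕ p ^ n

  open PowerMap pr n 1≤n Q (¬∣-%ℕ q (1<p pr) q⊥p (p∣p^n 1≤n))

  edge⇔arrow : ∀ x z → Edge p pr n q x z ⇔ Arrow (toℕ x) (toℕ z)
  edge⇔arrow x z = mk⇔
    (λ (y , y%N≡x , qʸ≡z) → y , y%N≡x , trans (sym (%ℕ-^ q ∣-refl y)) qʸ≡z)
    (λ (y , y%N≡x , power≡z) → y , y%N≡x , trans (%ℕ-^ q ∣-refl y) power≡z)

  labels : Vec (Vertex p n) k → Fin k → ℕ
  labels v i = toℕ (lookup v i)

  isCycle⇔ : ∀ v → IsCycle p pr n q k v ⇔ IsCycleℕ (labels v)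
  isCycle⇔ v = mk⇔
    (λ cyc j → Equivalence.to (edge⇔arrow (lookup v (cycPred j)) (lookup v j))
      (cyc (cycPred j) j (cycSucc-cycPred j)))
    (λ cyc i j i↦j → subst (λ i → Edge p pr n q (lookup v i) (lookup v j)) (sym (cycSucc⇒cycPred i↦j))
      (Equivalence.from (edge⇔arrow (lookup v (cycPred j)) (lookup v j)) (cyc j)))

  isCycle? : ∀ v → Dec (IsCycle p pr n q k v)
  isCycle? v = map′ (Equivalence.from (isCycle⇔ v)) (Equivalence.to (isCycle⇔ v))
    (Finₚ.all? λ j → arrow? (labels v (cycPred j)) (labels v j))

  #cycles : ℕ
  #cycles = length (filter isCycle? (allVecs (p ^ n) k))

  cycles-hasCard : HasCard (IsCycle p pr n q k) #cycles
  cycles-hasCard = filter-hasCard isCycle? (allVecs (p ^ n) k) (allVecs-unique (p ^ n) k) ∈-allVecs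

  residues : Vec (Vertex p n) k → Vec (Fin (p ∸ 1)) k
  residues = Vec.map (residue⁺ pr ∘ toℕ)

  residues-injective : ∀ {v v′} → IsCycle p pr n q k v → IsCycle p pr n q k v′ →
    residues v ≡ residues v′ → v ≡ v′
  residues-injective {v} {v′} cyc cyc′ same = lookup-ext v v′ λ i → Finₚ.toℕ-injective
    (cycle-determined-by-residues c c′ (λ i → Finₚ.toℕ<n (lookup v i)) (λ i → Finₚ.toℕ<n (lookup v′ i))
      (λ i → residue⁺-injective pr (¬∣-cycle c i) (¬∣-cycle c′ i) (begin
        residue⁺ pr (labels v i)  ≡⟨ Vecₚ.lookup-map i (residue⁺ pr ∘ toℕ) v ⟨
        lookup (residues v) i    ≡⟨ cong (λ w → lookup w i) same ⟩
        lookup (residues v′) i   ≡⟨ Vecₚ.lookup-map i (residue⁺ pr ∘ toℕ) v′ ⟩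
        residue⁺ pr (labels v′ i) ∎)) i)
    where
    c : IsCycleℕ (labels v)
    c = Equivalence.to (isCycle⇔ v) cyc
    c′ : IsCycleℕ (labels v′)
    c′ = Equivalence.to (isCycle⇔ v′) cyc′

  #cycles≤ : #cycles ≤ (p ∸ 1) ^ k
  #cycles≤ = subst (#cycles ≤_) (length-allVecs (p ∸ 1) k)
    (hasCard-≤ cycles-hasCard residues residues-injective (allVecs (p ∸ 1) k) ∈-allVecs)

  1%p≡1 : 1 % p ≡ 1
  1%p≡1 = m<n⇒m%n≡m (1<p pr)

  module _ (prim : PrimitiveRoot p pr q) where

    Qᵖ⁻¹≡1 : Q ^ (p ∸ 1) ≡ 1 mod p
    Qᵖ⁻¹≡1 = %≡⇒mod (trans (sym (%ℕ-^ q (p∣p^n 1≤n) (p ∸ 1))) (trans (proj₁ prim) (sym 1%p≡1)))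

    Qʲ≢1 : ∀ j → 0 < j → j < p ∸ 1 → ¬ Q ^ j ≡ 1 mod p
    Qʲ≢1 j 0<j j<p∸1 Qʲ≡1 =
      proj₂ prim j 0<j j<p∸1 (trans (%ℕ-^ q (p∣p^n 1≤n) j) (trans (mod⇒%≡ Qʲ≡1) 1%p≡1))

    open Primitive Qᵖ⁻¹≡1 Qʲ≢1

    cycleWithResidues : Vec (Fin (p ∸ 1)) k → Vec (Vertex p n) k
    cycleWithResidues r = tabulate (λ j → fromℕ< (approx<N n j))
      where open CycleWithResidues (lookup r)

    labels-cycleWithResidues : ∀ r j → labels (cycleWithResidues r) j ≡ CycleWithResidues.cycle (lookup r) j
    labels-cycleWithResidues r j =
      trans (cong toℕ (Vecₚ.lookup∘tabulate _ j)) (Finₚ.toℕ-fromℕ< (CycleWithResidues.approx<N (lookup r) n j))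

    cycleWithResidues-isCycle : ∀ r → IsCycle p pr n q k (cycleWithResidues r)
    cycleWithResidues-isCycle r = Equivalence.from (isCycle⇔ (cycleWithResidues r))
      (IsCycleℕ-cong (λ j → sym (labels-cycleWithResidues r j)) (CycleWithResidues.cycle-isCycle (lookup r)))

    residues-cycleWithResidues : ∀ r → residues (cycleWithResidues r) ≡ r
    residues-cycleWithResidues r = lookup-ext _ r λ j → begin
      lookup (residues (cycleWithResidues r)) j
        ≡⟨ Vecₚ.lookup-map j (residue⁺ pr ∘ toℕ) (cycleWithResidues r) ⟩
      residue⁺ pr (labels (cycleWithResidues r) j)
        ≡⟨ cong (residue⁺ pr) (labels-cycleWithResidues r j) ⟩
      residue⁺ pr (CycleWithResidues.cycle (lookup r) j)
        ≡⟨ CycleWithResidues.residue⁺-cycle (lookup r) j ⟩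
      lookup r j ∎

    ≤#cycles : (p ∸ 1) ^ k ≤ #cycles
    ≤#cycles = subst (_≤ #cycles) (length-allVecs (p ∸ 1) k)
      (≤-hasCard cycles-hasCard (allVecs (p ∸ 1) k) (allVecs-unique (p ∸ 1) k) cycleWithResidues
        cycleWithResidues-isCycle
        (λ {r} {r′} same → trans (sym (residues-cycleWithResidues r))
          (trans (cong residues same) (residues-cycleWithResidues r′))))

theorem1 : (p : ℕ) (pr : Prime p) (n k : ℕ) (q : ℤ) →
    1 ≤ n → 1 ≤ k → Coprime ∣ q ∣ p →
    Σ ℕ (λ C → HasCard (IsCycle p pr n q k) C
      × C ≤ (p ∸ 1) ^ℕ k
      × (PrimitiveRoot p pr q → C ≡ (p ∸ 1) ^ℕ k))
-- The count is right for k = 0 as well (both sides are 1).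
theorem1 p pr n k q 1≤n _ q⊥p =
  #cycles , cycles-hasCard , #cycles≤ , λ prim → ≤-antisym #cycles≤ (≤#cycles prim)
  where open CycleCount pr n k q 1≤n q⊥p
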